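{- For all $n\ge 3$, $\mathrm{r}_n(1324)=5\cdot 2^{n-2}-4$.
   Context: $\mathcal{S}_n$ is the set of permutations of $[n]$, $\pi^r$ the reversal of $\pi$. A word $w$ contains $\rho\in\mathcal{S}_k$ if some subsequence $w_{i_1}\cdots w_{i_k}$ ($i_1<\cdots<i_k$) satisfies $w_{i_a}\le w_{i_b}$ iff $\rho_a\le\rho_b$; otherwise it avoids $\rho$. $\mathcal{R}_n=\{\pi\pi^r:\pi\in\mathcal{S}_n\}$ (concatenation of $\pi$ with its reversal), and $\mathrm{r}_n(\rho)$ is the number of members of $\mathcal{R}_n$ avoiding $\rho$. -}

module Defs where

open import Data.Nat using (ℕ; zero; suc; _≤_)
open import Data.List using (List; []; _∷_; _++_; reverse; length; map; concatMap; upTo; lookup)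
open import Data.List.Relation.Binary.Sublist.Propositional using (_⊆_)
open import Data.List.Relation.Binary.Permutation.Propositional using (_↭_)
open import Data.Fin using (Fin)
open import Data.Product using (Σ; _×_; ∃)
open import Function.Bundles using (_⇔_)
open import Relation.Nullary using (¬_)
open import Relation.Binary.PropositionalEquality using (_≡_; subst)

oneTo : ℕ → List ℕ
oneTo n = map suc (upTo n)

IsPerm : ℕ → List ℕ → Set
IsPerm n π = π ↭ oneTo n

OrderIso : (u v : List ℕ) → Set
OrderIso u v = Σ (length u ≡ length v) λ e →
  (a b : Fin (length u)) →
    (lookup u a ≤ lookup u b) ⇔
    (lookup v (subst Fin e a) ≤ lookup v (subst Fin e b))

Contains : List ℕ → List ℕ → Set
Contains w ρ = Σ (List ℕ) λ s → (s ⊆ w) × OrderIso s ρ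

Avoids : List ℕ → List ℕ → Set
Avoids w ρ = ¬ Contains w ρ

doubleRev : List ℕ → List ℕ
doubleRev π = π ++ reverse π

-- Counting: r_n(ρ) = N means there is a duplicate-free list of exactly N
-- permutations of [n] containing every π ∈ S_n with π π^r avoiding ρ and
-- only such π.  (Distinct π give distinct π π^r, so this counts R_n members.)
open import Data.List.Relation.Unary.Unique.Propositional using (Unique)
open import Data.List.Membership.Propositional using (_∈_)

HasCount : (P : List ℕ → Set) → ℕ → Set
HasCount P N = Σ (List (List ℕ)) λ L →
  Unique L × (length L ≡ N) × ((π : List ℕ) → (π ∈ L) ⇔ P π)

RCount : ℕ → List ℕ → ℕ → Set
RCount n ρ N = HasCount (λ σ → Σ (List ℕ) λ π → IsPerm n π × (σ ≡ doubleRev π) × Avoids σ ρ) N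

-- π πʳ contains 1324 iff π contains one of 1324, 1342, 1432, 1423, 4132, 4123, 4213, 4231:
-- an occurrence splits between π and πʳ, and reading its πʳ-part backwards inside π
-- interleaves it with the π-part in one of 16 ways.  Write a permutation of [n + 1] as its
-- first letter v followed by a copy of a permutation p of [n] with the values ≥ v raised by one.
-- Then π avoids the eight patterns iff p does and either the second letter of π is adjacent to
-- v in value, or π starts 3 1 …, or π starts (n − 1) (n + 1) ….  For n ≥ 3 exactly two such
-- permutations of [n] start with 1 and two start with n, so their number aₙ satisfies
-- aₙ₊₁ = 2 aₙ + 4 with a₃ = 6, i.e. aₙ = 5 · 2ⁿ⁻² − 4; and π ↦ π πʳ is injective.

module Submission where

open import Defs
open import Data.Bool using (true; false; if_then_else_)
open import Data.Empty using (⊥-elim)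
open import Data.Fin using (Fin; #_) renaming (zero to fzero; suc to fsuc)
open import Data.List using (List; []; _∷_; _++_; reverse; length; lookup; map; filter)
open import Data.List.Membership.Propositional using (_∈_)
import Data.List.Membership.Propositional.Properties as ∈
open import Data.List.Membership.Propositional.Properties.WithK using (unique∧set⇒bag)
open import Data.List.Properties
  using (reverse-involutive; ∷-injective; map-injective; length-++; length-map; length-reverse;
         filter-++; filter-none)
open import Data.List.Relation.Binary.BagAndSetEquality using (∼bag⇒↭)
open import Data.List.Relation.Binary.Disjoint.Propositional using (Disjoint)
open import Data.List.Relation.Binary.Permutation.Propositional using (↭-sym; ↭⇒↭ₛ)
open import Data.List.Relation.Binary.Permutation.Propositional.Properties using (∈-resp-↭)
open import Data.List.Relation.Binary.Sublist.Propositional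
  using (_⊆_; []; _∷_; _∷ʳ_; ⊆-trans; minimum; from∈)
import Data.List.Relation.Binary.Sublist.Propositional.Properties as ⊆
open import Data.List.Relation.Ternary.Interleaving.Propositional using (Interleaving; []; consˡ; consʳ)
open import Data.List.Relation.Unary.All as All using (All; []; _∷_)
import Data.List.Relation.Unary.All.Properties as All
open import Data.List.Relation.Unary.AllPairs as AllPairs using ([]; _∷_)
open import Data.List.Relation.Unary.Any using (here; there)
import Data.List.Relation.Unary.Any.Properties as Any
open import Data.List.Relation.Unary.Unique.Propositional using (Unique)
import Data.List.Relation.Unary.Unique.Propositional.Properties as Unique
open import Data.Nat using (ℕ; zero; suc; pred; _≤_; _<_; _+_; _*_; _∸_; _^_; z≤n; s≤s; _≟_)
open import Data.Nat.Properties
open import Data.Nat.Tactic.RingSolver using (solve-∀)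
open import Data.Product using (Σ; _×_; _,_; proj₁; proj₂)
open import Data.Sum using (_⊎_; inj₁; inj₂)
open import Function using (id; _∘_)
open import Function.Bundles using (_⇔_; mk⇔; Equivalence)
open import Relation.Binary.Core using (_Preserves_⟶_)
open import Relation.Binary.Definitions using (tri<; tri≈; tri>)
open import Relation.Binary.PropositionalEquality
  using (_≡_; _≢_; refl; sym; trans; cong; cong₂; subst; setoid; module ≡-Reasoning)
open import Relation.Nullary using (¬_; yes; no; does)
open import Data.List.Relation.Binary.Permutation.Setoid.Properties (setoid ℕ) using (Unique-resp-↭)

data Occ1324 (w : List ℕ) : Set where
  occ1324 : ∀ {p q r s} → p ∷ q ∷ r ∷ s ∷ [] ⊆ w → p < r → r < q → q < s → Occ1324 w

OrderIso-reflects-< : ∀ {u v} ((e , iso) : OrderIso u v) (a b : Fin (length u)) →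
  lookup v (subst Fin e a) < lookup v (subst Fin e b) → lookup u a < lookup u b
OrderIso-reflects-< (e , iso) a b v<v = ≰⇒> λ u≤u → <⇒≱ v<v (Equivalence.to (iso b a) u≤u)

contains-1324⇒Occ1324 : ∀ {w} → Contains w (1 ∷ 3 ∷ 2 ∷ 4 ∷ []) → Occ1324 w
contains-1324⇒Occ1324 (_ ∷ _ ∷ _ ∷ _ ∷ [] , s⊆w , iso@(refl , _)) = occ1324 s⊆w
  (OrderIso-reflects-< iso (# 0) (# 2) (<ᵇ⇒< 1 2 _))
  (OrderIso-reflects-< iso (# 2) (# 1) (<ᵇ⇒< 2 3 _))
  (OrderIso-reflects-< iso (# 1) (# 3) (<ᵇ⇒< 3 4 _))

≤⇔≤-of-< : ∀ {x y x′ y′} → x < y → x′ < y′ → (x ≤ y ⇔ x′ ≤ y′)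
≤⇔≤-of-< x<y x′<y′ = mk⇔ (λ _ → <⇒≤ x′<y′) (λ _ → <⇒≤ x<y)

≤⇔≤-of-> : ∀ {x y x′ y′} → y < x → y′ < x′ → (x ≤ y ⇔ x′ ≤ y′)
≤⇔≤-of-> y<x y′<x′ = mk⇔ (λ x≤y → ⊥-elim (<⇒≱ y<x x≤y)) (λ x′≤y′ → ⊥-elim (<⇒≱ y′<x′ x′≤y′))

≤⇔≤-refl : ∀ {x x′} → (x ≤ x ⇔ x′ ≤ x′)
≤⇔≤-refl = mk⇔ (λ _ → ≤-refl) (λ _ → ≤-refl)

Occ1324⇒contains-1324 : ∀ {w} → Occ1324 w → Contains w (1 ∷ 3 ∷ 2 ∷ 4 ∷ [])
Occ1324⇒contains-1324 (occ1324 {p} {q} {r} {s} s⊆w p<r r<q q<s) =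
  p ∷ q ∷ r ∷ s ∷ [] , s⊆w , refl , compare
  where
  p<q : p < q
  p<q = <-trans p<r r<q
  r<s : r < s
  r<s = <-trans r<q q<s
  p<s : p < s
  p<s = <-trans p<q q<s
  compare : (a b : Fin 4) → let σ = p ∷ q ∷ r ∷ s ∷ [] ; ρ = 1 ∷ 3 ∷ 2 ∷ 4 ∷ [] in
            (lookup σ a ≤ lookup σ b) ⇔ (lookup ρ a ≤ lookup ρ b)
  compare fzero fzero                      = ≤⇔≤-refl
  compare fzero (fsuc fzero)               = ≤⇔≤-of-< p<q (<ᵇ⇒< 1 3 _)
  compare fzero (fsuc (fsuc fzero))        = ≤⇔≤-of-< p<r (<ᵇ⇒< 1 2 _)
  compare fzero (fsuc (fsuc (fsuc fzero))) = ≤⇔≤-of-< p<s (<ᵇ⇒< 1 4 _)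
  compare (fsuc fzero) fzero                      = ≤⇔≤-of-> p<q (<ᵇ⇒< 1 3 _)
  compare (fsuc fzero) (fsuc fzero)               = ≤⇔≤-refl
  compare (fsuc fzero) (fsuc (fsuc fzero))        = ≤⇔≤-of-> r<q (<ᵇ⇒< 2 3 _)
  compare (fsuc fzero) (fsuc (fsuc (fsuc fzero))) = ≤⇔≤-of-< q<s (<ᵇ⇒< 3 4 _)
  compare (fsuc (fsuc fzero)) fzero                      = ≤⇔≤-of-> p<r (<ᵇ⇒< 1 2 _)
  compare (fsuc (fsuc fzero)) (fsuc fzero)               = ≤⇔≤-of-< r<q (<ᵇ⇒< 2 3 _)
  compare (fsuc (fsuc fzero)) (fsuc (fsuc fzero))        = ≤⇔≤-refl
  compare (fsuc (fsuc fzero)) (fsuc (fsuc (fsuc fzero))) = ≤⇔≤-of-< r<s (<ᵇ⇒< 2 4 _)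
  compare (fsuc (fsuc (fsuc fzero))) fzero                      = ≤⇔≤-of-> p<s (<ᵇ⇒< 1 4 _)
  compare (fsuc (fsuc (fsuc fzero))) (fsuc fzero)               = ≤⇔≤-of-> q<s (<ᵇ⇒< 3 4 _)
  compare (fsuc (fsuc (fsuc fzero))) (fsuc (fsuc fzero))        = ≤⇔≤-of-> r<s (<ᵇ⇒< 2 4 _)
  compare (fsuc (fsuc (fsuc fzero))) (fsuc (fsuc (fsuc fzero))) = ≤⇔≤-refl

data HeadNotLeast (a b c : ℕ) : Set where
  p213 : b < a → a < c → HeadNotLeast a b c
  p231 : c < a → a < b → HeadNotLeast a b c
  p321 : c < b → b < a → HeadNotLeast a b c
  p312 : b < c → c < a → HeadNotLeast a b c

data HeadNotGreatest (a b c : ℕ) : Set where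
  p132 : a < c → c < b → HeadNotGreatest a b c
  p123 : a < b → b < c → HeadNotGreatest a b c
  p213 : b < a → a < c → HeadNotGreatest a b c
  p231 : c < a → a < b → HeadNotGreatest a b c

-- x a b c is order-isomorphic to one of 1324, 1342, 1432, 1423, 4132, 4123, 4213, 4231.
data Forbidden (x a b c : ℕ) : Set where
  below : x < a → x < b → x < c → HeadNotLeast a b c → Forbidden x a b c
  above : a < x → b < x → c < x → HeadNotGreatest a b c → Forbidden x a b c

data HasForbidden (π : List ℕ) : Set where
  forbidden : ∀ {x a b c} → x ∷ a ∷ b ∷ c ∷ [] ⊆ π → Forbidden x a b c → HasForbidden π

module _ {f g : ℕ → ℕ} (transport : ∀ {u w} → f u < f w → g u < g w) where

  HeadNotLeast-transport : ∀ {a b c} →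
    HeadNotLeast (f a) (f b) (f c) → HeadNotLeast (g a) (g b) (g c)
  HeadNotLeast-transport (p213 b<a a<c) = p213 (transport b<a) (transport a<c)
  HeadNotLeast-transport (p231 c<a a<b) = p231 (transport c<a) (transport a<b)
  HeadNotLeast-transport (p321 c<b b<a) = p321 (transport c<b) (transport b<a)
  HeadNotLeast-transport (p312 b<c c<a) = p312 (transport b<c) (transport c<a)

  HeadNotGreatest-transport : ∀ {a b c} →
    HeadNotGreatest (f a) (f b) (f c) → HeadNotGreatest (g a) (g b) (g c)
  HeadNotGreatest-transport (p132 a<c c<b) = p132 (transport a<c) (transport c<b)
  HeadNotGreatest-transport (p123 a<b b<c) = p123 (transport a<b) (transport b<c)
  HeadNotGreatest-transport (p213 b<a a<c) = p213 (transport b<a) (transport a<c)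
  HeadNotGreatest-transport (p231 c<a a<b) = p231 (transport c<a) (transport a<b)

  Forbidden-transport : ∀ {x a b c} →
    Forbidden (f x) (f a) (f b) (f c) → Forbidden (g x) (g a) (g b) (g c)
  Forbidden-transport (below x<a x<b x<c pat) =
    below (transport x<a) (transport x<b) (transport x<c) (HeadNotLeast-transport pat)
  Forbidden-transport (above a<x b<x c<x pat) =
    above (transport a<x) (transport b<x) (transport c<x) (HeadNotGreatest-transport pat)

HeadNotLeast⇒<head : ∀ {a b c} → HeadNotLeast a b c → b < a ⊎ c < a
HeadNotLeast⇒<head (p213 b<a _) = inj₁ b<a
HeadNotLeast⇒<head (p231 c<a _) = inj₂ c<a
HeadNotLeast⇒<head (p321 _ b<a) = inj₁ b<a
HeadNotLeast⇒<head (p312 _ c<a) = inj₂ c<a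

HeadNotGreatest⇒head< : ∀ {a b c} → HeadNotGreatest a b c → a < b ⊎ a < c
HeadNotGreatest⇒head< (p132 a<c _) = inj₂ a<c
HeadNotGreatest⇒head< (p123 a<b _) = inj₁ a<b
HeadNotGreatest⇒head< (p213 _ a<c) = inj₂ a<c
HeadNotGreatest⇒head< (p231 _ a<b) = inj₁ a<b

max-second⇒HeadNotGreatest : ∀ {a b c} → a < b → c < b → c ≢ a → HeadNotGreatest a b c
max-second⇒HeadNotGreatest {a} {c = c} a<b c<b c≢a with <-cmp c a
... | tri< c<a _ _ = p231 c<a a<b
... | tri≈ _ c≡a _ = ⊥-elim (c≢a c≡a)
... | tri> _ _ a<c = p132 a<c c<b

max-third⇒HeadNotGreatest : ∀ {a b c} → a < c → b < c → b ≢ a → HeadNotGreatest a b c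
max-third⇒HeadNotGreatest {a} {b} a<c b<c b≢a with <-cmp b a
... | tri< b<a _ _ = p213 b<a a<c
... | tri≈ _ b≡a _ = ⊥-elim (b≢a b≡a)
... | tri> _ _ a<b = p123 a<b b<c

min-second⇒HeadNotLeast : ∀ {a b c} → b < a → b < c → c ≢ a → HeadNotLeast a b c
min-second⇒HeadNotLeast {a} {c = c} b<a b<c c≢a with <-cmp c a
... | tri< c<a _ _ = p312 b<c c<a
... | tri≈ _ c≡a _ = ⊥-elim (c≢a c≡a)
... | tri> _ _ a<c = p213 b<a a<c

min-third⇒HeadNotLeast : ∀ {a b c} → c < a → c < b → b ≢ a → HeadNotLeast a b c
min-third⇒HeadNotLeast {a} {b} c<a c<b b≢a with <-cmp b a
... | tri< b<a _ _ = p321 c<b b<a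
... | tri≈ _ b≡a _ = ⊥-elim (b≢a b≡a)
... | tri> _ _ a<b = p231 c<a a<b

Window : ℕ → ℕ → Set
Window k z = k < z × z ≤ 2 + k

chain-spread : ∀ {k x y z} → k < x → x < y → y < z → 3 + k ≤ z
chain-spread k<x x<y y<z = ≤-trans (s≤s (≤-trans (s≤s k<x) x<y)) y<z

¬HeadNotLeast-in-window : ∀ {k a b c} → Window k a → Window k b → Window k c →
  ¬ HeadNotLeast a b c
¬HeadNotLeast-in-window _         (k<b , _) (_ , c≤) (p213 b<a a<c) = <⇒≱ (chain-spread k<b b<a a<c) c≤
¬HeadNotLeast-in-window _         (_ , b≤) (k<c , _) (p231 c<a a<b) = <⇒≱ (chain-spread k<c c<a a<b) b≤
¬HeadNotLeast-in-window (_ , a≤) _         (k<c , _) (p321 c<b b<a) = <⇒≱ (chain-spread k<c c<b b<a) a≤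
¬HeadNotLeast-in-window (_ , a≤) (k<b , _) _         (p312 b<c c<a) = <⇒≱ (chain-spread k<b b<c c<a) a≤

¬HeadNotGreatest-in-window : ∀ {k a b c} → Window k a → Window k b → Window k c →
  ¬ HeadNotGreatest a b c
¬HeadNotGreatest-in-window (k<a , _) (_ , b≤) _         (p132 a<c c<b) = <⇒≱ (chain-spread k<a a<c c<b) b≤
¬HeadNotGreatest-in-window (k<a , _) _         (_ , c≤) (p123 a<b b<c) = <⇒≱ (chain-spread k<a a<b b<c) c≤
¬HeadNotGreatest-in-window _         (k<b , _) (_ , c≤) (p213 b<a a<c) = <⇒≱ (chain-spread k<b b<a a<c) c≤
¬HeadNotGreatest-in-window _         (_ , b≤) (k<c , _) (p231 c<a a<b) = <⇒≱ (chain-spread k<c c<a a<b) b≤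

-- 1324 in π πʳ

data SublistSplit (xs as bs : List ℕ) : Set where
  split : ∀ us vs → us ⊆ as → vs ⊆ bs → us ++ vs ≡ xs → SublistSplit xs as bs

⊆-++-split : ∀ {xs} as bs → xs ⊆ as ++ bs → SublistSplit xs as bs
⊆-++-split [] bs h = split [] _ [] h refl
⊆-++-split (a ∷ as) bs (.a ∷ʳ h) with ⊆-++-split as bs h
... | split us vs us⊆ vs⊆ eq = split us vs (a ∷ʳ us⊆) vs⊆ eq
⊆-++-split (a ∷ as) bs (refl ∷ h) with ⊆-++-split as bs h
... | split us vs us⊆ vs⊆ eq = split (a ∷ us) vs (refl ∷ us⊆) vs⊆ (cong (a ∷_) eq)

data SublistMerge (xs ys π : List ℕ) : Set where
  merge : ∀ {zs} → Interleaving xs ys zs → zs ⊆ π → SublistMerge xs ys π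

⊆-merge : ∀ {xs ys π} → xs ⊆ π → ys ⊆ π → Disjoint xs ys → SublistMerge xs ys π
⊆-merge [] [] _ = merge [] []
⊆-merge (z ∷ʳ h₁) (.z ∷ʳ h₂) d with ⊆-merge h₁ h₂ d
... | merge i h = merge i (z ∷ʳ h)
⊆-merge (refl ∷ h₁) (z ∷ʳ h₂) d with ⊆-merge h₁ h₂ (λ (i , j) → d (there i , j))
... | merge i h = merge (consˡ i) (refl ∷ h)
⊆-merge (z ∷ʳ h₁) (refl ∷ h₂) d with ⊆-merge h₁ h₂ (λ (i , j) → d (i , there j))
... | merge i h = merge (consʳ i) (refl ∷ h)
⊆-merge (refl ∷ h₁) (refl ∷ h₂) d = ⊥-elim (d (here refl , here refl))

Unique-++⇒Disjoint : ∀ {us vs : List ℕ} → Unique (us ++ vs) → Disjoint us vs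
Unique-++⇒Disjoint {u ∷ us} (u∉ ∷ _) (here refl , v∈vs) = All.lookup u∉ (∈.∈-++⁺ʳ us v∈vs) refl
Unique-++⇒Disjoint {u ∷ us} (_ ∷ uniq) (there v∈us , v∈vs) = Unique-++⇒Disjoint uniq (v∈us , v∈vs)

⊆-reverse : ∀ {xs π : List ℕ} → xs ⊆ reverse π → reverse xs ⊆ π
⊆-reverse {xs} {π} h = subst (reverse xs ⊆_) (reverse-involutive π) (⊆.reverse⁺ h)

-- The occurrence p q r s splits as us ++ vs with us ⊆ π and reverse vs ⊆ π; the interleaving
-- of us and reverse vs inside π is one of 16 shapes, each one of the eight forbidden patterns.
Occ1324-doubleRev⇒HasForbidden : ∀ π → Occ1324 (doubleRev π) → HasForbidden π
Occ1324-doubleRev⇒HasForbidden π (occ1324 {p} {q} {r} {s} h p<r r<q q<s) =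
  fromSplit (⊆-++-split π (reverse π) h)
  where
  p<q : p < q
  p<q = <-trans p<r r<q
  r<s : r < s
  r<s = <-trans r<q q<s
  p<s : p < s
  p<s = <-trans p<q q<s
  distinct : Unique (p ∷ q ∷ r ∷ s ∷ [])
  distinct = (<⇒≢ p<q ∷ <⇒≢ p<r ∷ <⇒≢ p<s ∷ []) ∷ (>⇒≢ r<q ∷ <⇒≢ q<s ∷ []) ∷ (<⇒≢ r<s ∷ []) ∷ [] ∷ []
  shape : ∀ us vs → us ++ vs ≡ p ∷ q ∷ r ∷ s ∷ [] → ∀ {zs} → Interleaving us (reverse vs) zs → zs ⊆ π →
          HasForbidden π
  shape []                   _ refl (consʳ (consʳ (consʳ (consʳ [])))) z = forbidden z (above r<s q<s p<s (p231 p<r r<q))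
  shape (_ ∷ [])             _ refl (consˡ (consʳ (consʳ (consʳ [])))) z = forbidden z (below p<s p<r p<q (p312 r<q q<s))
  shape (_ ∷ [])             _ refl (consʳ (consˡ (consʳ (consʳ [])))) z = forbidden z (above p<s r<s q<s (p123 p<r r<q))
  shape (_ ∷ [])             _ refl (consʳ (consʳ (consˡ (consʳ [])))) z = forbidden z (above r<s p<s q<s (p213 p<r r<q))
  shape (_ ∷ [])             _ refl (consʳ (consʳ (consʳ (consˡ [])))) z = forbidden z (above r<s q<s p<s (p231 p<r r<q))
  shape (_ ∷ _ ∷ [])         _ refl (consˡ (consˡ (consʳ (consʳ [])))) z = forbidden z (below p<q p<s p<r (p231 r<q q<s))
  shape (_ ∷ _ ∷ [])         _ refl (consˡ (consʳ (consˡ (consʳ [])))) z = forbidden z (below p<s p<q p<r (p321 r<q q<s))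
  shape (_ ∷ _ ∷ [])         _ refl (consˡ (consʳ (consʳ (consˡ [])))) z = forbidden z (below p<s p<r p<q (p312 r<q q<s))
  shape (_ ∷ _ ∷ [])         _ refl (consʳ (consˡ (consˡ (consʳ [])))) z = forbidden z (above p<s q<s r<s (p132 p<r r<q))
  shape (_ ∷ _ ∷ [])         _ refl (consʳ (consˡ (consʳ (consˡ [])))) z = forbidden z (above p<s r<s q<s (p123 p<r r<q))
  shape (_ ∷ _ ∷ [])         _ refl (consʳ (consʳ (consˡ (consˡ [])))) z = forbidden z (above r<s p<s q<s (p213 p<r r<q))
  shape (_ ∷ _ ∷ _ ∷ [])     _ refl (consʳ (consˡ (consˡ (consˡ [])))) z = forbidden z (above p<s q<s r<s (p132 p<r r<q))
  shape (_ ∷ _ ∷ _ ∷ [])     _ refl (consˡ (consʳ (consˡ (consˡ [])))) z = forbidden z (below p<s p<q p<r (p321 r<q q<s))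
  shape (_ ∷ _ ∷ _ ∷ [])     _ refl (consˡ (consˡ (consʳ (consˡ [])))) z = forbidden z (below p<q p<s p<r (p231 r<q q<s))
  shape (_ ∷ _ ∷ _ ∷ [])     _ refl (consˡ (consˡ (consˡ (consʳ [])))) z = forbidden z (below p<q p<r p<s (p213 r<q q<s))
  shape (_ ∷ _ ∷ _ ∷ _ ∷ []) _ refl (consˡ (consˡ (consˡ (consˡ [])))) z = forbidden z (below p<q p<r p<s (p213 r<q q<s))
  fromSplit : SublistSplit (p ∷ q ∷ r ∷ s ∷ []) π (reverse π) → HasForbidden π
  fromSplit (split us vs us⊆π vs⊆πʳ eq)
    with ⊆-merge us⊆π (⊆-reverse vs⊆πʳ) (λ (i , j) →
           Unique-++⇒Disjoint (subst Unique (sym eq) distinct) (i , Any.reverse⁻ j))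
  ... | merge i zs⊆π = shape us vs eq i zs⊆π

++-reverse⁺ : ∀ {us vs π : List ℕ} → us ⊆ π → vs ⊆ π → us ++ reverse vs ⊆ doubleRev π
++-reverse⁺ us⊆π vs⊆π = ⊆.++⁺ us⊆π (⊆.reverse⁺ vs⊆π)

HasForbidden⇒Occ1324-doubleRev : ∀ π → HasForbidden π → Occ1324 (doubleRev π)
HasForbidden⇒Occ1324-doubleRev π (forbidden {x} {a} {b} {c} h F) = occurrence F
  where
  pick : ∀ {ys} → ys ⊆ x ∷ a ∷ b ∷ c ∷ [] → ys ⊆ π
  pick ys⊆ = ⊆-trans ys⊆ h
  occurrence : Forbidden x a b c → Occ1324 (doubleRev π)
  occurrence (below _ x<b _ (p213 b<a a<c)) =
    occ1324 (++-reverse⁺ h (minimum π)) x<b b<a a<c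
  occurrence (below _ _ x<c (p231 c<a a<b)) =
    occ1324 (++-reverse⁺ (pick (refl ∷ refl ∷ b ∷ʳ c ∷ʳ [])) (pick (x ∷ʳ a ∷ʳ refl ∷ refl ∷ []))) x<c c<a a<b
  occurrence (below _ _ x<c (p321 c<b b<a)) =
    occ1324 (++-reverse⁺ (pick (refl ∷ a ∷ʳ refl ∷ c ∷ʳ [])) (pick (x ∷ʳ refl ∷ b ∷ʳ refl ∷ []))) x<c c<b b<a
  occurrence (below _ x<b _ (p312 b<c c<a)) =
    occ1324 (++-reverse⁺ (pick (refl ∷ a ∷ʳ b ∷ʳ refl ∷ [])) (pick (x ∷ʳ refl ∷ refl ∷ c ∷ʳ []))) x<b b<c c<a
  occurrence (above _ b<x _ (p132 a<c c<b)) =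
    occ1324 (++-reverse⁺ (pick (x ∷ʳ refl ∷ refl ∷ refl ∷ [])) (pick (refl ∷ a ∷ʳ b ∷ʳ c ∷ʳ []))) a<c c<b b<x
  occurrence (above _ _ c<x (p123 a<b b<c)) =
    occ1324 (++-reverse⁺ (pick (x ∷ʳ refl ∷ b ∷ʳ refl ∷ [])) (pick (refl ∷ a ∷ʳ refl ∷ c ∷ʳ []))) a<b b<c c<x
  occurrence (above _ _ c<x (p213 b<a a<c)) =
    occ1324 (++-reverse⁺ (pick (x ∷ʳ a ∷ʳ refl ∷ refl ∷ [])) (pick (refl ∷ refl ∷ b ∷ʳ c ∷ʳ []))) b<a a<c c<x
  occurrence (above _ b<x _ (p231 c<a a<b)) =
    occ1324 (++-reverse⁺ (pick (x ∷ʳ a ∷ʳ b ∷ʳ refl ∷ [])) (pick (refl ∷ refl ∷ refl ∷ c ∷ʳ []))) c<a a<b b<x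

contains-1324-doubleRev⇔HasForbidden : ∀ π →
  Contains (doubleRev π) (1 ∷ 3 ∷ 2 ∷ 4 ∷ []) ⇔ HasForbidden π
contains-1324-doubleRev⇔HasForbidden π = mk⇔
  (λ c → Occ1324-doubleRev⇒HasForbidden π (contains-1324⇒Occ1324 c))
  (λ F → Occ1324⇒contains-1324 (HasForbidden⇒Occ1324-doubleRev π F))

-- Shifting values and prepending a first letter

⊆-map⁻ : ∀ (f : ℕ → ℕ) p {xs} → xs ⊆ map f p → Σ (List ℕ) λ ys → ys ⊆ p × map f ys ≡ xs
⊆-map⁻ f [] [] = [] , [] , refl
⊆-map⁻ f (z ∷ p) (_ ∷ʳ h) with ⊆-map⁻ f p h
... | ys , ys⊆p , refl = ys , z ∷ʳ ys⊆p , refl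
⊆-map⁻ f (z ∷ p) (refl ∷ h) with ⊆-map⁻ f p h
... | ys , ys⊆p , refl = z ∷ ys , refl ∷ ys⊆p , refl

HasForbidden-map⁺ : ∀ f → f Preserves _<_ ⟶ _<_ → ∀ {p} → HasForbidden p → HasForbidden (map f p)
HasForbidden-map⁺ f mono (forbidden h F) = forbidden (⊆.map⁺ f h) (Forbidden-transport {f = id} mono F)

HasForbidden-map⁻ : ∀ f → (∀ {u w} → f u < f w → u < w) → ∀ {p} → HasForbidden (map f p) → HasForbidden p
HasForbidden-map⁻ f reflects {p} (forbidden h F) with ⊆-map⁻ f p h
... | _ ∷ _ ∷ _ ∷ _ ∷ [] , h′ , refl = forbidden h′ (Forbidden-transport {g = id} reflects F)

shiftFrom : ℕ → ℕ → ℕ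
shiftFrom zero    z       = suc z
shiftFrom (suc v) zero    = zero
shiftFrom (suc v) (suc z) = suc (shiftFrom v z)

unshiftFrom : ℕ → ℕ → ℕ
unshiftFrom zero    z       = pred z
unshiftFrom (suc v) zero    = zero
unshiftFrom (suc v) (suc z) = suc (unshiftFrom v z)

shiftFrom-< : ∀ {v z} → z < v → shiftFrom v z ≡ z
shiftFrom-< {suc v} {zero}  _         = refl
shiftFrom-< {suc v} {suc z} (s≤s z<v) = cong suc (shiftFrom-< z<v)

shiftFrom-≥ : ∀ {v z} → v ≤ z → shiftFrom v z ≡ suc z
shiftFrom-≥ {zero}          _         = refl
shiftFrom-≥ {suc v} {suc z} (s≤s v≤z) = cong suc (shiftFrom-≥ v≤z)

unshiftFrom-< : ∀ {v z} → z < v → unshiftFrom v z ≡ z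
unshiftFrom-< {suc v} {zero}  _         = refl
unshiftFrom-< {suc v} {suc z} (s≤s z<v) = cong suc (unshiftFrom-< z<v)

unshiftFrom-> : ∀ {v z} → v < z → unshiftFrom v z ≡ pred z
unshiftFrom-> {zero}  {suc z}       _         = refl
unshiftFrom-> {suc v} {suc (suc z)} (s≤s v<z) = cong suc (unshiftFrom-> v<z)

shiftFrom-unshiftFrom : ∀ v {z} → z ≢ v → shiftFrom v (unshiftFrom v z) ≡ z
shiftFrom-unshiftFrom zero    {zero}  z≢v = ⊥-elim (z≢v refl)
shiftFrom-unshiftFrom zero    {suc z} _   = refl
shiftFrom-unshiftFrom (suc v) {zero}  _   = refl
shiftFrom-unshiftFrom (suc v) {suc z} z≢v = cong suc (shiftFrom-unshiftFrom v (z≢v ∘ cong suc))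

shiftFrom-≢ : ∀ v z → shiftFrom v z ≢ v
shiftFrom-≢ (suc v) (suc z) eq = shiftFrom-≢ v z (suc-injective eq)

≤-shiftFrom : ∀ v z → z ≤ shiftFrom v z
≤-shiftFrom zero    z       = n≤1+n z
≤-shiftFrom (suc v) zero    = z≤n
≤-shiftFrom (suc v) (suc z) = s≤s (≤-shiftFrom v z)

shiftFrom-≤ : ∀ v z → shiftFrom v z ≤ suc z
shiftFrom-≤ zero    z       = ≤-refl
shiftFrom-≤ (suc v) zero    = z≤n
shiftFrom-≤ (suc v) (suc z) = s≤s (shiftFrom-≤ v z)

shiftFrom-mono-< : ∀ v → shiftFrom v Preserves _<_ ⟶ _<_
shiftFrom-mono-< zero    u<w                     = s≤s u<w
shiftFrom-mono-< (suc v) {zero}  {suc w} _       = s≤s z≤n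
shiftFrom-mono-< (suc v) {suc u} {suc w} (s≤s u<w) = s≤s (shiftFrom-mono-< v u<w)

shiftFrom-cancel-< : ∀ v {u w} → shiftFrom v u < shiftFrom v w → u < w
shiftFrom-cancel-< v {u} {w} lt with <-cmp u w
... | tri< u<w _ _ = u<w
... | tri≈ _ refl _ = ⊥-elim (<-irrefl refl lt)
... | tri> _ _ w<u = ⊥-elim (<-asym lt (shiftFrom-mono-< v w<u))

shiftFrom-injective : ∀ v {u w} → shiftFrom v u ≡ shiftFrom v w → u ≡ w
shiftFrom-injective v {u} {w} eq with <-cmp u w
... | tri< u<w _ _ = ⊥-elim (<-irrefl eq (shiftFrom-mono-< v u<w))
... | tri≈ _ u≡w _ = u≡w
... | tri> _ _ w<u = ⊥-elim (<-irrefl (sym eq) (shiftFrom-mono-< v w<u))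

-- The junk value 0 on [] never matters: permutations of [n] for n ≥ 1 are nonempty.
first : List ℕ → ℕ
first []      = 0
first (x ∷ _) = x

prepend : ℕ → List ℕ → List ℕ
prepend v p = v ∷ map (shiftFrom v) p

prepend-injective : ∀ {a b p q} → prepend a p ≡ prepend b q → a ≡ b × p ≡ q
prepend-injective {a} eq with ∷-injective eq
... | refl , tails = refl , map-injective (shiftFrom-injective a) tails

record PermOf (n : ℕ) (π : List ℕ) : Set where
  field
    distinct : Unique π
    inRange  : ∀ {z} → z ∈ π → 1 ≤ z × z ≤ n
    complete : ∀ {z} → 1 ≤ z → z ≤ n → z ∈ π
open PermOf

∈-oneTo⁻ : ∀ {n z} → z ∈ oneTo n → 1 ≤ z × z ≤ n
∈-oneTo⁻ z∈ with ∈.∈-map⁻ suc z∈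
... | _ , y∈ , refl = s≤s z≤n , ∈.∈-upTo⁻ y∈

∈-oneTo⁺ : ∀ {n z} → 1 ≤ z → z ≤ n → z ∈ oneTo n
∈-oneTo⁺ {z = suc y} _ y<n = ∈.∈-map⁺ suc (∈.∈-upTo⁺ y<n)

Unique-oneTo : ∀ n → Unique (oneTo n)
Unique-oneTo n = Unique.map⁺ suc-injective (Unique.upTo⁺ n)

IsPerm⇒PermOf : ∀ {n π} → IsPerm n π → PermOf n π
IsPerm⇒PermOf {n} π↭ = record
  { distinct = Unique-resp-↭ (↭⇒↭ₛ (↭-sym π↭)) (Unique-oneTo n)
  ; inRange  = λ z∈ → ∈-oneTo⁻ (∈-resp-↭ π↭ z∈)
  ; complete = λ 1≤z z≤n′ → ∈-resp-↭ (↭-sym π↭) (∈-oneTo⁺ 1≤z z≤n′)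
  }

PermOf⇒IsPerm : ∀ {n π} → PermOf n π → IsPerm n π
PermOf⇒IsPerm {n} P = ∼bag⇒↭ (unique∧set⇒bag (distinct P) (Unique-oneTo n) (mk⇔
  (λ z∈π → ∈-oneTo⁺ (proj₁ (inRange P z∈π)) (proj₂ (inRange P z∈π)))
  (λ z∈ → complete P (proj₁ (∈-oneTo⁻ z∈)) (proj₂ (∈-oneTo⁻ z∈)))))

PermOf-first : ∀ {n p} → PermOf (suc n) p → 1 ≤ first p × first p ≤ suc n
PermOf-first {p = []}    P with complete P (s≤s z≤n) (s≤s z≤n)
... | ()
PermOf-first {p = _ ∷ _} P = inRange P (here refl)

shiftFrom-inRange : ∀ v {n y} → 1 ≤ y → y ≤ n → 1 ≤ shiftFrom v y × shiftFrom v y ≤ suc n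
shiftFrom-inRange v {y = y} 1≤y y≤n = ≤-trans 1≤y (≤-shiftFrom v y) , ≤-trans (shiftFrom-≤ v y) (s≤s y≤n)

prepend-PermOf : ∀ {n p v} → PermOf n p → 1 ≤ v → v ≤ suc n → PermOf (suc n) (prepend v p)
prepend-PermOf {n} {p} {v} P 1≤v v≤1+n = record
  { distinct = All.tabulate v≢ ∷ Unique.map⁺ (shiftFrom-injective v) (distinct P)
  ; inRange  = range
  ; complete = cover
  }
  where
  v≢ : ∀ {z} → z ∈ map (shiftFrom v) p → v ≢ z
  v≢ z∈ with ∈.∈-map⁻ (shiftFrom v) z∈
  ... | y , _ , refl = shiftFrom-≢ v y ∘ sym
  range : ∀ {z} → z ∈ prepend v p → 1 ≤ z × z ≤ suc n
  range (here refl) = 1≤v , v≤1+n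
  range (there z∈) with ∈.∈-map⁻ (shiftFrom v) z∈
  ... | y , y∈p , refl = shiftFrom-inRange v (proj₁ (inRange P y∈p)) (proj₂ (inRange P y∈p))
  cover : ∀ {z} → 1 ≤ z → z ≤ suc n → z ∈ prepend v p
  cover {suc y} 1≤z z≤1+n with <-cmp (suc y) v
  ... | tri≈ _ refl _ = here refl
  ... | tri< z<v _ _ = there (subst (_∈ map (shiftFrom v) p) (shiftFrom-< z<v)
          (∈.∈-map⁺ (shiftFrom v) (complete P 1≤z (≤-pred (<-≤-trans z<v v≤1+n)))))
  ... | tri> _ _ (s≤s v≤y) = there (subst (_∈ map (shiftFrom v) p) (shiftFrom-≥ v≤y)
          (∈.∈-map⁺ (shiftFrom v) (complete P (≤-trans 1≤v v≤y) (≤-pred z≤1+n))))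

prepend-PermOf⁻ : ∀ {n v p} → PermOf (suc n) (prepend v p) → PermOf n p
prepend-PermOf⁻ {n} {v} {p} P = record
  { distinct = Unique.map⁻ (AllPairs.tail (distinct P))
  ; inRange  = range
  ; complete = cover
  }
  where
  1≤v : 1 ≤ v
  1≤v = proj₁ (inRange P (here refl))
  v≤1+n : v ≤ suc n
  v≤1+n = proj₂ (inRange P (here refl))
  range : ∀ {y} → y ∈ p → 1 ≤ y × y ≤ n
  range {y} y∈p with inRange P (there (∈.∈-map⁺ (shiftFrom v) y∈p)) | y <? v
  ... | 1≤y , _ | yes y<v rewrite shiftFrom-< y<v = 1≤y , ≤-pred (<-≤-trans y<v v≤1+n)
  ... | _ , 1+y≤ | no y≮v rewrite shiftFrom-≥ (≮⇒≥ y≮v) = ≤-trans 1≤v (≮⇒≥ y≮v) , ≤-pred 1+y≤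
  cover : ∀ {y} → 1 ≤ y → y ≤ n → y ∈ p
  cover {y} 1≤y y≤n with shiftFrom-inRange v 1≤y y≤n
  ... | lo , hi with complete P lo hi
  ... | here eq = ⊥-elim (shiftFrom-≢ v y eq)
  ... | there z∈ with ∈.∈-map⁻ (shiftFrom v) z∈
  ...   | y′ , y′∈p , eq = subst (_∈ p) (shiftFrom-injective v (sym eq)) y′∈p

map-shiftFrom-unshiftFrom : ∀ {v} ρ → All (v ≢_) ρ → map (shiftFrom v) (map (unshiftFrom v) ρ) ≡ ρ
map-shiftFrom-unshiftFrom []      []          = refl
map-shiftFrom-unshiftFrom {v} (z ∷ ρ) (v≢z ∷ v≢ρ) =
  cong₂ _∷_ (shiftFrom-unshiftFrom v (v≢z ∘ sym)) (map-shiftFrom-unshiftFrom ρ v≢ρ)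

-- First letters that keep a permutation forbidden-free

HasForbidden-prepend⁺ : ∀ v {p} → HasForbidden p → HasForbidden (prepend v p)
HasForbidden-prepend⁺ v F with HasForbidden-map⁺ (shiftFrom v) (shiftFrom-mono-< v) F
... | forbidden h G = forbidden (v ∷ʳ h) G

¬HasForbidden-shiftFrom : ∀ v {p} → ¬ HasForbidden p → ¬ HasForbidden (map (shiftFrom v) p)
¬HasForbidden-shiftFrom v avoid = avoid ∘ HasForbidden-map⁻ (shiftFrom v) (shiftFrom-cancel-< v)

prepend-avoids : ∀ {v p} → ¬ HasForbidden p →
  (∀ {a b c} → a ∷ b ∷ c ∷ [] ⊆ map (shiftFrom v) p → ¬ Forbidden v a b c) →
  ¬ HasForbidden (prepend v p)
prepend-avoids {v} avoid _   (forbidden (_ ∷ʳ h) F) = ¬HasForbidden-shiftFrom v avoid (forbidden h F)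
prepend-avoids     _   new (forbidden (refl ∷ h) F) = new h F

Adjacent : ℕ → ℕ → Set
Adjacent x y = y ≡ suc x ⊎ x ≡ suc y

Adjacent-shiftFrom : ∀ {v f} → v ≡ f ⊎ v ≡ suc f → Adjacent v (shiftFrom v f)
Adjacent-shiftFrom (inj₁ refl)      = inj₁ (shiftFrom-≥ ≤-refl)
Adjacent-shiftFrom {f = f} (inj₂ refl) = inj₂ (cong suc (sym (shiftFrom-< (n<1+n f))))

Adjacent-¬Forbidden : ∀ {x y b c} → Adjacent x y → ¬ Forbidden x y b c
Adjacent-¬Forbidden (inj₁ refl) (below _ x<b x<c pat) with HeadNotLeast⇒<head pat
... | inj₁ b<1+x = <⇒≱ x<b (≤-pred b<1+x)
... | inj₂ c<1+x = <⇒≱ x<c (≤-pred c<1+x)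
Adjacent-¬Forbidden (inj₁ refl) (above 1+x<x _ _ _) = <-asym 1+x<x (n<1+n _)
Adjacent-¬Forbidden (inj₂ refl) (below 1+y<y _ _ _) = <-asym 1+y<y (n<1+n _)
Adjacent-¬Forbidden (inj₂ refl) (above _ b<x c<x pat) with HeadNotGreatest⇒head< pat
... | inj₁ y<b = <⇒≱ y<b (≤-pred b<x)
... | inj₂ y<c = <⇒≱ y<c (≤-pred c<x)

-- Across adjacent values x and y, any other letter compares with y as it does with x.
Forbidden-replace-adjacent : ∀ {x y a b c} → Adjacent x y → a ≢ y → b ≢ y → c ≢ y →
  Forbidden x a b c → Forbidden y a b c
Forbidden-replace-adjacent adj a≢y b≢y c≢y (below x<a x<b x<c pat) =
  below (above-x adj a≢y x<a) (above-x adj b≢y x<b) (above-x adj c≢y x<c) pat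
  where
  above-x : ∀ {x y z} → Adjacent x y → z ≢ y → x < z → y < z
  above-x (inj₁ refl) z≢y x<z = ≤∧≢⇒< x<z (z≢y ∘ sym)
  above-x (inj₂ refl) _   x<z = <-trans (n<1+n _) x<z
Forbidden-replace-adjacent adj a≢y b≢y c≢y (above a<x b<x c<x pat) =
  above (below-x adj a≢y a<x) (below-x adj b≢y b<x) (below-x adj c≢y c<x) pat
  where
  below-x : ∀ {x y z} → Adjacent x y → z ≢ y → z < x → z < y
  below-x (inj₁ refl) _   z<x = <-trans z<x (n<1+n _)
  below-x (inj₂ refl) z≢y z<x = ≤∧≢⇒< (≤-pred z<x) z≢y

prepend-adjacent-avoids : ∀ {v p} → Unique p → ¬ HasForbidden p → Adjacent v (shiftFrom v (first p)) →
  ¬ HasForbidden (prepend v p)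
prepend-adjacent-avoids {p = []}    _             avoid _   = prepend-avoids avoid λ ()
prepend-adjacent-avoids {v} {f ∷ t} (f∉t ∷ _) avoid adj = prepend-avoids avoid new
  where
  ≢first : All (_≢ shiftFrom v f) (map (shiftFrom v) t)
  ≢first = All.gmap⁺ (λ f≢y eq → f≢y (sym (shiftFrom-injective v eq))) f∉t
  new : ∀ {a b c} → a ∷ b ∷ c ∷ [] ⊆ map (shiftFrom v) (f ∷ t) → ¬ Forbidden v a b c
  new (refl ∷ _)   F = Adjacent-¬Forbidden adj F
  new (_ ∷ʳ abc⊆) F with ⊆.All-resp-⊆ abc⊆ ≢first
  ... | a≢ ∷ b≢ ∷ c≢ ∷ [] = ¬HasForbidden-shiftFrom v avoid
          (forbidden (refl ∷ abc⊆) (Forbidden-replace-adjacent adj a≢ b≢ c≢ F))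

prepend-3-avoids : ∀ {p} → first p ≡ 1 → All (1 ≤_) p → ¬ HasForbidden p → ¬ HasForbidden (prepend 3 p)
prepend-3-avoids {1 ∷ t} refl positive avoid = prepend-avoids avoid new
  where
  positive′ : All (1 ≤_) (map (shiftFrom 3) (1 ∷ t))
  positive′ = All.gmap⁺ (λ {y} 1≤y → ≤-trans 1≤y (≤-shiftFrom 3 y)) positive
  new : ∀ {a b c} → a ∷ b ∷ c ∷ [] ⊆ map (shiftFrom 3) (1 ∷ t) → ¬ Forbidden 3 a b c
  new (refl ∷ _)   (below (s≤s ()) _ _ _)
  new (_ ∷ʳ abc⊆) (below 3<a 3<b 3<c pat) = ¬HasForbidden-shiftFrom 3 avoid (forbidden (refl ∷ abc⊆)
    (below (<-trans 1<3 3<a) (<-trans 1<3 3<b) (<-trans 1<3 3<c) pat))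
    where
    1<3 : 1 < 3
    1<3 = <ᵇ⇒< 1 3 _
  new abc⊆ (above a<3 b<3 c<3 pat) with ⊆.All-resp-⊆ abc⊆ positive′
  ... | 1≤a ∷ 1≤b ∷ 1≤c ∷ [] =
    ¬HeadNotGreatest-in-window (1≤a , ≤-pred a<3) (1≤b , ≤-pred b<3) (1≤c , ≤-pred c<3) pat

prepend-below-max-avoids : ∀ {m p} → first p ≡ suc m → All (_≤ suc m) p → ¬ HasForbidden p →
  ¬ HasForbidden (prepend m p)
prepend-below-max-avoids {m} {suc m ∷ t} refl bounded avoid = prepend-avoids avoid new
  where
  top : shiftFrom m (suc m) ≡ 2 + m
  top = shiftFrom-≥ (n≤1+n m)
  bounded′ : All (_≤ 2 + m) (map (shiftFrom m) (suc m ∷ t))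
  bounded′ = All.gmap⁺ (λ {y} y≤ → ≤-trans (shiftFrom-≤ m y) (s≤s y≤)) bounded
  m<2+m : m < 2 + m
  m<2+m = ≤-trans (n<1+n m) (n≤1+n (suc m))
  new : ∀ {a b c} → a ∷ b ∷ c ∷ [] ⊆ map (shiftFrom m) (suc m ∷ t) → ¬ Forbidden m a b c
  new abc⊆ (below m<a m<b m<c pat) with ⊆.All-resp-⊆ abc⊆ bounded′
  ... | a≤ ∷ b≤ ∷ c≤ ∷ [] = ¬HeadNotLeast-in-window (m<a , a≤) (m<b , b≤) (m<c , c≤) pat
  new (refl ∷ _)   (above a<m _ _ _) = <-asym m<2+m (subst (_< m) top a<m)
  new (_ ∷ʳ abc⊆) (above a<m b<m c<m pat) = ¬HasForbidden-shiftFrom m avoid (forbidden (refl ∷ abc⊆)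
    (subst (λ x → Forbidden x _ _ _) (sym top)
      (above (<-trans a<m m<2+m) (<-trans b<m m<2+m) (<-trans c<m m<2+m) pat)))

⊆-pair : ∀ {u w : ℕ} {t} → u ∈ t → w ∈ t → u ≢ w → (u ∷ w ∷ [] ⊆ t) ⊎ (w ∷ u ∷ [] ⊆ t)
⊆-pair (here refl) (here refl) u≢w = ⊥-elim (u≢w refl)
⊆-pair (here refl) (there w∈t) _   = inj₁ (refl ∷ from∈ w∈t)
⊆-pair (there u∈t) (here refl) _   = inj₂ (refl ∷ from∈ u∈t)
⊆-pair {t = z ∷ _} (there u∈t) (there w∈t) u≢w with ⊆-pair u∈t w∈t u≢w
... | inj₁ h = inj₁ (z ∷ʳ h)
... | inj₂ h = inj₂ (z ∷ʳ h)

HasForbidden-above-pair : ∀ {v y u w t} → y < u → u < v → w < u → w ≢ y → u ∈ t → w ∈ t →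
  HasForbidden (v ∷ y ∷ t)
HasForbidden-above-pair y<u u<v w<u w≢y u∈t w∈t with ⊆-pair u∈t w∈t (>⇒≢ w<u)
... | inj₁ h = forbidden (refl ∷ refl ∷ h)
  (above (<-trans y<u u<v) u<v (<-trans w<u u<v) (max-second⇒HeadNotGreatest y<u w<u w≢y))
... | inj₂ h = forbidden (refl ∷ refl ∷ h)
  (above (<-trans y<u u<v) (<-trans w<u u<v) u<v (max-third⇒HeadNotGreatest y<u w<u w≢y))

HasForbidden-below-pair : ∀ {v y u w t} → u < y → v < u → u < w → w ≢ y → u ∈ t → w ∈ t →
  HasForbidden (v ∷ y ∷ t)
HasForbidden-below-pair u<y v<u u<w w≢y u∈t w∈t with ⊆-pair u∈t w∈t (<⇒≢ u<w)
... | inj₁ h = forbidden (refl ∷ refl ∷ h)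
  (below (<-trans v<u u<y) v<u (<-trans v<u u<w) (min-second⇒HeadNotLeast u<y u<w w≢y))
... | inj₂ h = forbidden (refl ∷ refl ∷ h)
  (below (<-trans v<u u<y) (<-trans v<u u<w) v<u (min-third⇒HeadNotLeast u<y u<w w≢y))

choose-≢ : ∀ m y → Σ ℕ λ w → m ≤ w × w ≤ suc m × w ≢ y
choose-≢ m y with y ≟ m
... | yes refl = suc m , n≤1+n m , ≤-refl , 1+n≢n
... | no  y≢m  = m , ≤-refl , n≤1+n m , y≢m ∘ sym

∈-drop₂ : ∀ {z v y : ℕ} {t} → z ∈ v ∷ y ∷ t → z ≢ v → z ≢ y → z ∈ t
∈-drop₂ (here z≡v)         z≢v _   = ⊥-elim (z≢v z≡v)
∈-drop₂ (there (here z≡y)) _   z≢y = ⊥-elim (z≢y z≡y)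
∈-drop₂ (there (there z∈t)) _  _   = z∈t

-- Otherwise u = v − 1 and some w ∈ {1, 2} ∖ {y} follow y, and v y u w or v y w u is forbidden.
descent-gap : ∀ {n v y t} → PermOf n (v ∷ y ∷ t) → ¬ HasForbidden (v ∷ y ∷ t) → 2 + y ≤ v →
  v ≡ 3 × y ≡ 1
descent-gap {n} {suc u} {y} {t} P avoid (s≤s y<u) with u ≤? 2
... | yes u≤2 =
  cong suc (≤-antisym u≤2 (≤-trans (s≤s 1≤y) y<u)) , ≤-antisym (≤-pred (≤-trans y<u u≤2)) 1≤y
  where
  1≤y : 1 ≤ y
  1≤y = proj₁ (inRange P (there (here refl)))
... | no u≰2 with choose-≢ 1 y
...   | w , 1≤w , w≤2 , w≢y = ⊥-elim (avoid (HasForbidden-above-pair y<u (n<1+n u) w<u w≢y u∈t w∈t))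
  where
  w<u : w < u
  w<u = ≤-<-trans w≤2 (≰⇒> u≰2)
  1+u≤n : suc u ≤ n
  1+u≤n = proj₂ (inRange P (here refl))
  u∈t : u ∈ t
  u∈t = ∈-drop₂ (complete P (≤-trans 1≤w (<⇒≤ w<u)) (≤-trans (n≤1+n u) 1+u≤n)) (<⇒≢ (n<1+n u)) (>⇒≢ y<u)
  w∈t : w ∈ t
  w∈t = ∈-drop₂ (complete P 1≤w (≤-trans (<⇒≤ w<u) (≤-trans (n≤1+n u) 1+u≤n)))
                (<⇒≢ (<-trans w<u (n<1+n u))) w≢y

-- Otherwise u = v + 1 and some w ∈ {n − 1, n} ∖ {y} follow y, and v y u w or v y w u is forbidden.
ascent-gap : ∀ {n v y t} → PermOf n (v ∷ y ∷ t) → ¬ HasForbidden (v ∷ y ∷ t) → 2 + v ≤ y →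
  y ≡ n × 2 + v ≡ n
ascent-gap {zero} P _ 2+v≤y =
  ⊥-elim (<⇒≱ (≤-trans (s≤s z≤n) 2+v≤y) (proj₂ (inRange P (there (here refl)))))
ascent-gap {suc n′} {v} {y} {t} P avoid 2+v≤y with n′ ≤? suc v
... | yes n′≤1+v =
  ≤-antisym y≤n (≤-trans (s≤s n′≤1+v) 2+v≤y) , ≤-antisym (≤-trans 2+v≤y y≤n) (s≤s n′≤1+v)
  where
  y≤n : y ≤ suc n′
  y≤n = proj₂ (inRange P (there (here refl)))
... | no n′≰1+v with choose-≢ n′ y
...   | w , n′≤w , w≤n , w≢y = ⊥-elim (avoid (HasForbidden-below-pair 2+v≤y (n<1+n v) u<w w≢y u∈t w∈t))
  where
  u<w : suc v < w
  u<w = <-≤-trans (≰⇒> n′≰1+v) n′≤w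
  u∈t : suc v ∈ t
  u∈t = ∈-drop₂ (complete P (s≤s z≤n) (≤-trans (<⇒≤ u<w) w≤n)) (>⇒≢ (n<1+n v)) (<⇒≢ 2+v≤y)
  w∈t : w ∈ t
  w∈t = ∈-drop₂ (complete P (≤-trans (s≤s z≤n) u<w) w≤n) (>⇒≢ (<-trans (n<1+n v) u<w)) w≢y

-- Listing the forbidden-free permutations

startingWith : ℕ → List (List ℕ) → List (List ℕ)
startingWith j = filter (λ p → first p ≟ j)

adjacentExtensions : List (List ℕ) → List (List ℕ)
adjacentExtensions []       = []
adjacentExtensions (p ∷ ps) = prepend (first p) p ∷ prepend (suc (first p)) p ∷ adjacentExtensions ps

-- On permutations of [m + 1], the starts 3 1 … and m (m + 2) … allowed by descent-gap and ascent-gap.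
gapExtensions : ℕ → List (List ℕ) → List (List ℕ)
gapExtensions zero      _ = []
gapExtensions m@(suc _) L =
  map (prepend 3) (startingWith 1 L) ++ map (prepend m) (startingWith (suc m) L)

avoiders : ℕ → List (List ℕ)
avoiders zero          = [] ∷ []
avoiders (suc zero)    = (1 ∷ []) ∷ []
avoiders (suc (suc m)) = adjacentExtensions (avoiders (suc m)) ++ gapExtensions m (avoiders (suc m))

record Enumerates (n : ℕ) (L : List (List ℕ)) : Set where
  field
    unique     : Unique L
    sound      : ∀ {π} → π ∈ L → PermOf n π × ¬ HasForbidden π
    exhaustive : ∀ {π} → PermOf n π → ¬ HasForbidden π → π ∈ L
open Enumerates

data AdjacentExtension (L : List (List ℕ)) (π : List ℕ) : Set where
  adjacent : ∀ {q a} → q ∈ L → a ≡ first q ⊎ a ≡ suc (first q) → π ≡ prepend a q → AdjacentExtension L π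

data GapExtension (m : ℕ) (L : List (List ℕ)) (π : List ℕ) : Set where
  gap-3   : ∀ {q} → q ∈ L → first q ≡ 1     → π ≡ prepend 3 q → GapExtension m L π
  gap-top : ∀ {q} → q ∈ L → first q ≡ suc m → π ≡ prepend m q → GapExtension m L π

∈-adjacentExtensions⁻ : ∀ {L π} → π ∈ adjacentExtensions L → AdjacentExtension L π
∈-adjacentExtensions⁻ {p ∷ _} (here eq)         = adjacent (here refl) (inj₁ refl) eq
∈-adjacentExtensions⁻ {p ∷ _} (there (here eq)) = adjacent (here refl) (inj₂ refl) eq
∈-adjacentExtensions⁻ {p ∷ _} (there (there π∈)) with ∈-adjacentExtensions⁻ π∈
... | adjacent q∈ a≡ eq = adjacent (there q∈) a≡ eq

∈-adjacentExtensions⁺ : ∀ {L q a} → q ∈ L → a ≡ first q ⊎ a ≡ suc (first q) →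
  prepend a q ∈ adjacentExtensions L
∈-adjacentExtensions⁺ (here refl) (inj₁ refl) = here refl
∈-adjacentExtensions⁺ (here refl) (inj₂ refl) = there (here refl)
∈-adjacentExtensions⁺ (there q∈)  a≡          = there (there (∈-adjacentExtensions⁺ q∈ a≡))

∈-startingWith⁻ : ∀ {j} L {q} → q ∈ startingWith j L → q ∈ L × first q ≡ j
∈-startingWith⁻ {j} L = ∈.∈-filter⁻ (λ p → first p ≟ j) {xs = L}

∈-startingWith⁺ : ∀ {j L q} → q ∈ L → first q ≡ j → q ∈ startingWith j L
∈-startingWith⁺ {j} = ∈.∈-filter⁺ (λ p → first p ≟ j)

∈-gapExtensions⁻ : ∀ m L {π} → π ∈ gapExtensions m L → GapExtension m L π
∈-gapExtensions⁻ (suc k) L π∈ with ∈.∈-++⁻ (map (prepend 3) (startingWith 1 L)) π∈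
... | inj₁ π∈₁ with ∈.∈-map⁻ (prepend 3) π∈₁
...   | q , q∈ , eq = gap-3 (proj₁ (∈-startingWith⁻ L q∈)) (proj₂ (∈-startingWith⁻ L q∈)) eq
∈-gapExtensions⁻ (suc k) L π∈ | inj₂ π∈₂ with ∈.∈-map⁻ (prepend (suc k)) π∈₂
...   | q , q∈ , eq = gap-top (proj₁ (∈-startingWith⁻ L q∈)) (proj₂ (∈-startingWith⁻ L q∈)) eq

∈-gapExtensions-3⁺ : ∀ {m L q} → 1 ≤ m → q ∈ L → first q ≡ 1 → prepend 3 q ∈ gapExtensions m L
∈-gapExtensions-3⁺ {suc k} _ q∈ first≡ = ∈.∈-++⁺ˡ (∈.∈-map⁺ (prepend 3) (∈-startingWith⁺ q∈ first≡))

∈-gapExtensions-top⁺ : ∀ {m L q} → 1 ≤ m → q ∈ L → first q ≡ suc m → prepend m q ∈ gapExtensions m L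
∈-gapExtensions-top⁺ {suc k} {L} _ q∈ first≡ =
  ∈.∈-++⁺ʳ (map (prepend 3) (startingWith 1 L)) (∈.∈-map⁺ (prepend (suc k)) (∈-startingWith⁺ q∈ first≡))

Unique-adjacentExtensions : ∀ {L} → Unique L → Unique (adjacentExtensions L)
Unique-adjacentExtensions {[]}     []          = []
Unique-adjacentExtensions {p ∷ ps} (p∉ps ∷ u) =
  (differ ∷ All.tabulate (fresh (first p))) ∷ All.tabulate (fresh (suc (first p))) ∷
  Unique-adjacentExtensions u
  where
  differ : prepend (first p) p ≢ prepend (suc (first p)) p
  differ eq = 1+n≢n (sym (proj₁ (prepend-injective eq)))
  fresh : ∀ a {π} → π ∈ adjacentExtensions ps → prepend a p ≢ π
  fresh a π∈ eq with ∈-adjacentExtensions⁻ π∈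
  ... | adjacent q∈ _ refl = All.lookup p∉ps q∈ (proj₂ (prepend-injective eq))

Unique-gapExtensions : ∀ {m L} → Unique L → Unique (gapExtensions m L)
Unique-gapExtensions {zero}  _ = []
Unique-gapExtensions {suc k} {L} u =
  Unique.++⁺ (prepends-unique 3 1) (prepends-unique (suc k) (2 + k)) disjoint
  where
  prepends-unique : ∀ a j → Unique (map (prepend a) (startingWith j L))
  prepends-unique a j = Unique.map⁺ (proj₂ ∘ prepend-injective) (Unique.filter⁺ (λ p → first p ≟ j) u)
  disjoint : Disjoint (map (prepend 3) (startingWith 1 L)) (map (prepend (suc k)) (startingWith (2 + k) L))
  disjoint (π∈₁ , π∈₂) with ∈.∈-map⁻ (prepend 3) π∈₁ | ∈.∈-map⁻ (prepend (suc k)) π∈₂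
  ... | q , q∈ , refl | q′ , q′∈ , eq with prepend-injective eq
  ...   | _ , refl = 1+n≢0 (suc-injective
            (trans (sym (proj₂ (∈-startingWith⁻ L q′∈))) (proj₂ (∈-startingWith⁻ L q∈))))

adjacent-gap-disjoint : ∀ {m L} → Disjoint (adjacentExtensions L) (gapExtensions m L)
adjacent-gap-disjoint {m} {L} (π∈₁ , π∈₂) with ∈-adjacentExtensions⁻ π∈₁ | ∈-gapExtensions⁻ m L π∈₂
... | adjacent _ a≡ refl | gap-3 _ first≡ eq with prepend-injective eq
...   | refl , refl = not-adjacent a≡ first≡
  where
  not-adjacent : ∀ {f} → 3 ≡ f ⊎ 3 ≡ suc f → f ≢ 1
  not-adjacent (inj₁ refl) ()
  not-adjacent (inj₂ refl) ()
adjacent-gap-disjoint {m} {L} (π∈₁ , π∈₂) | adjacent _ a≡ refl | gap-top _ first≡ eq with prepend-injective eq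
...   | refl , refl = not-adjacent a≡ first≡
  where
  not-adjacent : ∀ {f} → m ≡ f ⊎ m ≡ suc f → f ≢ suc m
  not-adjacent (inj₁ refl) = 1+n≢n ∘ sym
  not-adjacent (inj₂ refl) ()

adjacent-start-inRange : ∀ {n q a} → PermOf (suc n) q → a ≡ first q ⊎ a ≡ suc (first q) →
  1 ≤ a × a ≤ 2 + n
adjacent-start-inRange P (inj₁ refl) =
  proj₁ (PermOf-first P) , ≤-trans (proj₂ (PermOf-first P)) (n≤1+n _)
adjacent-start-inRange P (inj₂ refl) = s≤s z≤n , s≤s (proj₂ (PermOf-first P))

extensions-sound : ∀ {m L} → Enumerates (suc m) L →
  ∀ {π} → π ∈ adjacentExtensions L ++ gapExtensions m L →
  PermOf (2 + m) π × ¬ HasForbidden π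
extensions-sound {m} {L} E π∈ with ∈.∈-++⁻ (adjacentExtensions L) π∈
... | inj₁ π∈adj with ∈-adjacentExtensions⁻ π∈adj
...   | adjacent q∈ a≡ refl with sound E q∈ | adjacent-start-inRange (proj₁ (sound E q∈)) a≡
...     | P , avoid | 1≤a , a≤ =
  prepend-PermOf P 1≤a a≤ , prepend-adjacent-avoids (distinct P) avoid (Adjacent-shiftFrom a≡)
extensions-sound {suc k} {L} E π∈ | inj₂ π∈gap with ∈-gapExtensions⁻ (suc k) L π∈gap
... | gap-3 q∈ first≡ refl with sound E q∈
...   | P , avoid = prepend-PermOf P (s≤s z≤n) (s≤s (s≤s (s≤s z≤n))) ,
                    prepend-3-avoids first≡ (All.tabulate (proj₁ ∘ inRange P)) avoid
extensions-sound {suc k} {L} E π∈ | inj₂ π∈gap | gap-top q∈ first≡ refl with sound E q∈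
...   | P , avoid = prepend-PermOf P (s≤s z≤n) (≤-trans (n≤1+n _) (n≤1+n _)) ,
                    prepend-below-max-avoids first≡ (All.tabulate (proj₂ ∘ inRange P)) avoid

prepend-unshiftFrom : ∀ {n v ρ} → PermOf n (v ∷ ρ) → prepend v (map (unshiftFrom v) ρ) ≡ v ∷ ρ
prepend-unshiftFrom {v = v} {ρ} P =
  cong (v ∷_) (map-shiftFrom-unshiftFrom ρ (AllPairs.head (distinct P)))

unshiftFrom-tail-∈ : ∀ {m L v ρ} → Enumerates (suc m) L →
  PermOf (2 + m) (v ∷ ρ) → ¬ HasForbidden (v ∷ ρ) →
  map (unshiftFrom v) ρ ∈ L
unshiftFrom-tail-∈ {m} {v = v} E P avoid = exhaustive E
  (prepend-PermOf⁻ (subst (PermOf (2 + m)) (sym (prepend-unshiftFrom P)) P))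
  (λ F → avoid (subst HasForbidden (prepend-unshiftFrom P) (HasForbidden-prepend⁺ v F)))

prepend-∈-extensions : ∀ {m L v y t} → map (unshiftFrom v) (y ∷ t) ∈ L →
  PermOf (2 + m) (v ∷ y ∷ t) → ¬ HasForbidden (v ∷ y ∷ t) →
  prepend v (map (unshiftFrom v) (y ∷ t)) ∈ adjacentExtensions L ++ gapExtensions m L
prepend-∈-extensions {m} {L} {v} {y} p∈L P avoid with <-cmp y v
... | tri≈ _ refl _ = ⊥-elim (All.head (AllPairs.head (distinct P)) refl)
... | tri< y<v _ _ with suc y ≟ v
...   | yes refl = ∈.∈-++⁺ˡ (∈-adjacentExtensions⁺ p∈L (inj₂ (cong suc (sym (unshiftFrom-< y<v)))))
...   | no 1+y≢v with descent-gap P avoid (≤∧≢⇒< y<v 1+y≢v)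
...     | refl , refl = ∈.∈-++⁺ʳ (adjacentExtensions L)
          (∈-gapExtensions-3⁺ (≤-pred (≤-pred (proj₂ (inRange P (here refl))))) p∈L refl)
prepend-∈-extensions {m} {L} {v} {y} p∈L P avoid | tri> _ _ v<y with suc v ≟ y
...   | yes refl = ∈.∈-++⁺ˡ (∈-adjacentExtensions⁺ p∈L (inj₁ (sym (unshiftFrom-> (n<1+n v)))))
...   | no 1+v≢y with ascent-gap P avoid (≤∧≢⇒< v<y 1+v≢y)
...     | refl , 2+v≡2+m with suc-injective (suc-injective 2+v≡2+m)
...       | refl = ∈.∈-++⁺ʳ (adjacentExtensions L)
          (∈-gapExtensions-top⁺ (proj₁ (inRange P (here refl))) p∈L
             (unshiftFrom-> (≤-trans (n<1+n _) (n≤1+n _))))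

extensions-exhaustive : ∀ {m L} → Enumerates (suc m) L → ∀ {π} → PermOf (2 + m) π → ¬ HasForbidden π →
  π ∈ adjacentExtensions L ++ gapExtensions m L
extensions-exhaustive E {[]} P _ with complete P (s≤s z≤n) (s≤s z≤n)
... | ()
extensions-exhaustive E {_ ∷ []} P _
  with complete P {1} (s≤s z≤n) (s≤s z≤n) | complete P {2} (s≤s z≤n) (s≤s (s≤s z≤n))
... | here refl | here ()
extensions-exhaustive {m} {L} E {_ ∷ _ ∷ _} P avoid =
  subst (_∈ adjacentExtensions L ++ gapExtensions m L) (prepend-unshiftFrom P)
    (prepend-∈-extensions (unshiftFrom-tail-∈ E P avoid) P avoid)

extensions-enumerate : ∀ {m L} → Enumerates (suc m) L →
  Enumerates (2 + m) (adjacentExtensions L ++ gapExtensions m L)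
extensions-enumerate {m} E = record
  { unique     = Unique.++⁺ (Unique-adjacentExtensions (unique E)) (Unique-gapExtensions {m} (unique E))
                            (adjacent-gap-disjoint {m})
  ; sound      = extensions-sound E
  ; exhaustive = extensions-exhaustive E
  }

PermOf-1 : PermOf 1 (1 ∷ [])
PermOf-1 = record
  { distinct = [] ∷ []
  ; inRange  = λ { (here refl) → ≤-refl , ≤-refl }
  ; complete = λ { (s≤s z≤n) (s≤s z≤n) → here refl }
  }

PermOf-1⁻ : ∀ {π} → PermOf 1 π → π ≡ 1 ∷ []
PermOf-1⁻ {[]} P with complete P (s≤s z≤n) (s≤s z≤n)
... | ()
PermOf-1⁻ {_ ∷ []} P with inRange P (here refl)
... | s≤s z≤n , s≤s z≤n = refl
PermOf-1⁻ {_ ∷ _ ∷ _} P with inRange P (here refl) | inRange P (there (here refl))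
... | s≤s z≤n , s≤s z≤n | s≤s z≤n , s≤s z≤n = ⊥-elim (All.head (AllPairs.head (distinct P)) refl)

¬HasForbidden-1 : ¬ HasForbidden (1 ∷ [])
¬HasForbidden-1 (forbidden (_ ∷ʳ ()) _)
¬HasForbidden-1 (forbidden (_ ∷ ()) _)

avoiders-enumerate : ∀ m → Enumerates (suc m) (avoiders (suc m))
avoiders-enumerate zero = record
  { unique     = [] ∷ []
  ; sound      = λ { (here refl) → PermOf-1 , ¬HasForbidden-1 }
  ; exhaustive = λ P _ → here (PermOf-1⁻ P)
  }
avoiders-enumerate (suc m) = extensions-enumerate (avoiders-enumerate m)

-- Counting

length-adjacentExtensions : ∀ L → length (adjacentExtensions L) ≡ length L + length L
length-adjacentExtensions []       = refl
length-adjacentExtensions (p ∷ ps) =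
  cong suc (trans (cong suc (length-adjacentExtensions ps)) (sym (+-suc (length ps) (length ps))))

module _ (j : ℕ) where

  #startingWith : List (List ℕ) → ℕ
  #startingWith L = length (startingWith j L)

  startsWith : List ℕ → ℕ
  startsWith q = if does (first q ≟ j) then 1 else 0

  #startingWith-∷ : ∀ q qs → #startingWith (q ∷ qs) ≡ startsWith q + #startingWith qs
  #startingWith-∷ q qs with does (first q ≟ j)
  ... | true  = refl
  ... | false = refl

  #startingWith-none : ∀ {L} → All (λ q → first q ≢ j) L → #startingWith L ≡ 0
  #startingWith-none none = cong length (filter-none (λ p → first p ≟ j) none)

  #startingWith-++ : ∀ xs ys → #startingWith (xs ++ ys) ≡ #startingWith xs + #startingWith ys
  #startingWith-++ xs ys =
    trans (cong length (filter-++ (λ p → first p ≟ j) xs ys)) (length-++ (startingWith j xs))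

-- startsWith (suc j) (prepend (suc (first p)) p) reduces to startsWith j p, as suc m ≟ suc n computes as m ≟ n.
#startingWith-adjacentExtensions : ∀ j L →
  #startingWith (suc j) (adjacentExtensions L) ≡ #startingWith (suc j) L + #startingWith j L
#startingWith-adjacentExtensions j []       = refl
#startingWith-adjacentExtensions j (p ∷ ps) = begin
  #startingWith (suc j) (prepend f p ∷ prepend (suc f) p ∷ E)
    ≡⟨ #startingWith-∷ (suc j) (prepend f p) (prepend (suc f) p ∷ E) ⟩
  a + #startingWith (suc j) (prepend (suc f) p ∷ E)
    ≡⟨ cong (a +_) (#startingWith-∷ (suc j) (prepend (suc f) p) E) ⟩
  a + (b + #startingWith (suc j) E)
    ≡⟨ cong (λ x → a + (b + x)) (#startingWith-adjacentExtensions j ps) ⟩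
  a + (b + (#startingWith (suc j) ps + #startingWith j ps))
    ≡⟨ interchange a b (#startingWith (suc j) ps) (#startingWith j ps) ⟩
  (a + #startingWith (suc j) ps) + (b + #startingWith j ps)
    ≡⟨ cong₂ _+_ (#startingWith-∷ (suc j) p ps) (#startingWith-∷ j p ps) ⟨
  #startingWith (suc j) (p ∷ ps) + #startingWith j (p ∷ ps)
    ∎
  where
  open ≡-Reasoning
  f a b : ℕ
  f = first p
  a = startsWith (suc j) p
  b = startsWith j p
  E : List (List ℕ)
  E = adjacentExtensions ps
  interchange : ∀ a b c d → a + (b + (c + d)) ≡ (a + c) + (b + d)
  interchange = solve-∀

All-first-prepend : ∀ {a j} xs → a ≢ j → All (λ q → first q ≢ j) (map (prepend a) xs)
All-first-prepend xs a≢j = All.map⁺ (All.universal (λ _ → a≢j) xs)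

#startingWith-gapExtensions : ∀ j k L → 3 ≢ j → suc k ≢ j → #startingWith j (gapExtensions (suc k) L) ≡ 0
#startingWith-gapExtensions j k L 3≢j 1+k≢j = #startingWith-none j
  (All.++⁺ (All-first-prepend (startingWith 1 L) 3≢j) (All-first-prepend (startingWith (2 + k) L) 1+k≢j))

length-gapExtensions : ∀ k L →
  length (gapExtensions (suc k) L) ≡ #startingWith 1 L + #startingWith (2 + k) L
length-gapExtensions k L = trans (length-++ (map (prepend 3) (startingWith 1 L)))
  (cong₂ _+_ (length-map (prepend 3) (startingWith 1 L))
             (length-map (prepend (suc k)) (startingWith (2 + k) L)))

first-avoiders : ∀ m → All (λ p → 1 ≤ first p × first p ≤ suc m) (avoiders (suc m))
first-avoiders m = All.tabulate (PermOf-first ∘ proj₁ ∘ sound (avoiders-enumerate m))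

#startingWith-avoiders : ∀ k →
  #startingWith 1 (avoiders (3 + k)) ≡ 2 × #startingWith (3 + k) (avoiders (3 + k)) ≡ 2
#startingWith-avoiders zero    = refl , refl
#startingWith-avoiders (suc k) = count-1 , count-top
  where
  open ≡-Reasoning
  A G : List (List ℕ)
  A = avoiders (3 + k)
  G = gapExtensions (2 + k) A
  none-0 : #startingWith 0 A ≡ 0
  none-0 = #startingWith-none 0
    (All.map (λ (1≤f , _) f≡0 → <⇒≢ 1≤f (sym f≡0)) (first-avoiders (2 + k)))
  none-top : #startingWith (4 + k) A ≡ 0
  none-top = #startingWith-none (4 + k)
    (All.map (λ (_ , f≤) f≡ → 1+n≰n (subst (_≤ 3 + k) f≡ f≤)) (first-avoiders (2 + k)))
  count-1 : #startingWith 1 (adjacentExtensions A ++ G) ≡ 2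
  count-1 = begin
    #startingWith 1 (adjacentExtensions A ++ G)
      ≡⟨ #startingWith-++ 1 (adjacentExtensions A) G ⟩
    #startingWith 1 (adjacentExtensions A) + #startingWith 1 G
      ≡⟨ cong₂ _+_ (#startingWith-adjacentExtensions 0 A)
                   (#startingWith-gapExtensions 1 (suc k) A (λ ()) (λ ())) ⟩
    #startingWith 1 A + #startingWith 0 A + 0
      ≡⟨ cong₂ (λ a b → a + b + 0) (proj₁ (#startingWith-avoiders k)) none-0 ⟩
    2 ∎
  count-top : #startingWith (4 + k) (adjacentExtensions A ++ G) ≡ 2
  count-top = begin
    #startingWith (4 + k) (adjacentExtensions A ++ G)
      ≡⟨ #startingWith-++ (4 + k) (adjacentExtensions A) G ⟩
    #startingWith (4 + k) (adjacentExtensions A) + #startingWith (4 + k) G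
      ≡⟨ cong₂ _+_ (#startingWith-adjacentExtensions (3 + k) A)
                   (#startingWith-gapExtensions (4 + k) (suc k) A (λ ()) (<⇒≢ (≤-trans (n<1+n _) (n≤1+n _)))) ⟩
    #startingWith (4 + k) A + #startingWith (3 + k) A + 0
      ≡⟨ cong₂ (λ a b → a + b + 0) none-top (proj₂ (#startingWith-avoiders k)) ⟩
    2 ∎

length-avoiders : ∀ k → length (avoiders (3 + k)) + 4 ≡ 5 * 2 ^ suc k
length-avoiders zero    = refl
length-avoiders (suc k) = begin
  length (adjacentExtensions A ++ gapExtensions (2 + k) A) + 4
    ≡⟨ cong (_+ 4) (length-++ (adjacentExtensions A)) ⟩
  length (adjacentExtensions A) + length (gapExtensions (2 + k) A) + 4
    ≡⟨ cong₂ (λ a b → a + b + 4) (length-adjacentExtensions A) (length-gapExtensions (suc k) A) ⟩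
  length A + length A + (#startingWith 1 A + #startingWith (3 + k) A) + 4
    ≡⟨ cong₂ (λ a b → length A + length A + (a + b) + 4)
             (proj₁ (#startingWith-avoiders k)) (proj₂ (#startingWith-avoiders k)) ⟩
  length A + length A + 4 + 4
    ≡⟨ regroup (length A) ⟩
  (length A + 4) + (length A + 4)
    ≡⟨ cong₂ _+_ (length-avoiders k) (length-avoiders k) ⟩
  5 * 2 ^ suc k + 5 * 2 ^ suc k
    ≡⟨ double (2 ^ suc k) ⟩
  5 * 2 ^ suc (suc k) ∎
  where
  open ≡-Reasoning
  A : List (List ℕ)
  A = avoiders (3 + k)
  regroup : ∀ a → a + a + 4 + 4 ≡ (a + 4) + (a + 4)
  regroup = solve-∀
  double : ∀ x → 5 * x + 5 * x ≡ 5 * (2 * x)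
  double = solve-∀

+-double-injective : ∀ {m n} → m + m ≡ n + n → m ≡ n
+-double-injective {m} {n} eq with <-cmp m n
... | tri< m<n _ _ = ⊥-elim (<⇒≢ (+-mono-< m<n m<n) eq)
... | tri≈ _ m≡n _ = m≡n
... | tri> _ _ n<m = ⊥-elim (<⇒≢ (+-mono-< n<m n<m) (sym eq))

++-injectiveˡ-length : ∀ (a b : List ℕ) {x y} → length a ≡ length b → a ++ x ≡ b ++ y → a ≡ b
++-injectiveˡ-length []      []      _   _  = refl
++-injectiveˡ-length (u ∷ a) (w ∷ b) len eq with ∷-injective eq
... | refl , eq′ = cong (u ∷_) (++-injectiveˡ-length a b (suc-injective len) eq′)

length-doubleRev : ∀ π → length (doubleRev π) ≡ length π + length π
length-doubleRev π = trans (length-++ π) (cong (length π +_) (length-reverse π))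

doubleRev-injective : ∀ {a b} → doubleRev a ≡ doubleRev b → a ≡ b
doubleRev-injective {a} {b} eq = ++-injectiveˡ-length a b
  (+-double-injective (trans (sym (length-doubleRev a)) (trans (cong length eq) (length-doubleRev b))))
  eq

Enumerates⇒RCount-1324 : ∀ {n L} → Enumerates n L → RCount n (1 ∷ 3 ∷ 2 ∷ 4 ∷ []) (length L)
Enumerates⇒RCount-1324 {n} {L} E =
  map doubleRev L , Unique.map⁺ doubleRev-injective (unique E) , length-map doubleRev L ,
  λ σ → mk⇔ to from
  where
  to : ∀ {σ} → σ ∈ map doubleRev L →
       Σ (List ℕ) λ π → IsPerm n π × σ ≡ doubleRev π × Avoids σ (1 ∷ 3 ∷ 2 ∷ 4 ∷ [])
  to σ∈ with ∈.∈-map⁻ doubleRev σ∈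
  ... | π , π∈L , refl = π , PermOf⇒IsPerm (proj₁ (sound E π∈L)) , refl ,
                         proj₂ (sound E π∈L) ∘ Equivalence.to (contains-1324-doubleRev⇔HasForbidden π)
  from : ∀ {σ} → (Σ (List ℕ) λ π → IsPerm n π × σ ≡ doubleRev π × Avoids σ (1 ∷ 3 ∷ 2 ∷ 4 ∷ [])) →
         σ ∈ map doubleRev L
  from (π , π↭ , refl , avoid) = ∈.∈-map⁺ doubleRev (exhaustive E (IsPerm⇒PermOf π↭)
    (avoid ∘ Equivalence.from (contains-1324-doubleRev⇔HasForbidden π)))

theorem10 : (n : ℕ) → 3 ≤ n → RCount n (1 ∷ 3 ∷ 2 ∷ 4 ∷ []) (5 * 2 ^ (n ∸ 2) ∸ 4)
theorem10 1 (s≤s ())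
theorem10 2 (s≤s (s≤s ()))
theorem10 (suc (suc (suc k))) _ =
  subst (RCount (3 + k) (1 ∷ 3 ∷ 2 ∷ 4 ∷ [])) count (Enumerates⇒RCount-1324 (avoiders-enumerate (2 + k)))
  where
  count : length (avoiders (3 + k)) ≡ 5 * 2 ^ suc k ∸ 4
  count = trans (sym (m+n∸n≡m _ 4)) (cong (_∸ 4) (length-avoiders k))
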